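{- Let $s,t$ be positive integers and define sequences $(A_n)_{n\ge 0}$, $(B_n)_{n\ge 0}$ of nonnegative integers by $$A_n=\operatorname{mex}\{A_i,B_i:0\le i<n\},\qquad B_n=sA_n+tn\qquad(n\ge 0).$$ Then there exist real numbers $\alpha,\gamma,\beta,\delta$ such that $A_n=\lfloor n\alpha+\gamma\rfloor$ and $B_n=\lfloor n\beta+\delta\rfloor$ for all integers $n\ge 0$ if and only if $s=1$.
   Context: For a finite set $S$ of nonnegative integers, $\operatorname{mex} S$ denotes the least nonnegative integer not in $S$ (so $\operatorname{mex}\emptyset=0$). -}

module Defs where

open import Level using (0ℓ)
open import Data.Nat as ℕ using (ℕ; suc)
open import Data.Integer using (+_)
open import Data.Rational as ℚ using (ℚ; _/_)
open import Data.Product using (Σ; ∃; _×_; _,_)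
open import Data.Sum using (_⊎_)
open import Relation.Nullary using (¬_)
open import Relation.Binary.PropositionalEquality using (_≡_)

-- Real numbers as (two-sided, located) Dedekind cuts of ℚ.
-- lower q  means  q < x ;  upper r  means  x < r.

record ℝ : Set₁ where
  field
    lower     : ℚ → Set
    upper     : ℚ → Set
    lower-inh : ∃ λ q → lower q
    upper-inh : ∃ λ r → upper r
    lower-rounded₁ : ∀ q → lower q → ∃ λ r → (q ℚ.< r) × lower r
    lower-rounded₂ : ∀ q r → q ℚ.< r → lower r → lower q
    upper-rounded₁ : ∀ r → upper r → ∃ λ q → (q ℚ.< r) × upper q
    upper-rounded₂ : ∀ q r → q ℚ.< r → upper q → upper r
    disjoint  : ∀ q → ¬ (lower q × upper q)
    located   : ∀ q r → q ℚ.< r → lower q ⊎ upper r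

open ℝ public

ℕ→ℚ : ℕ → ℚ
ℕ→ℚ n = (+ n) / 1

-- n·α + γ < r   (for α γ : ℝ, n : ℕ, r : ℚ)
LinLt : ℝ → ℝ → ℕ → ℚ → Set
LinLt α γ n r = ∃ λ a → ∃ λ b → upper α a × upper γ b × (ℕ→ℚ n ℚ.* a ℚ.+ b ℚ.< r)

-- ⌊ n·α + γ ⌋ = m, i.e.  m ≤ n·α + γ < m + 1
FloorLinEq : ℝ → ℝ → ℕ → ℕ → Set
FloorLinEq α γ n m = ¬ LinLt α γ n (ℕ→ℚ m) × LinLt α γ n (ℕ→ℚ (suc m))

InPrefix : (ℕ → ℕ) → (ℕ → ℕ) → ℕ → ℕ → Set
InPrefix A B n k = ∃ λ i → (i ℕ.< n) × (A i ≡ k ⊎ B i ≡ k)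

IsMex : (ℕ → Set) → ℕ → Set
IsMex S m = ¬ S m × (∀ k → k ℕ.< m → S k)

{-# OPTIONS --safe #-}
module Submission where

-- For s = 1 the sequences are the complementary Beatty sequences A n = ⌊nα⌋, B n = ⌊nβ⌋ with
-- β = α + t and 1/α + 1/β = 1, i.e. α is the positive root of x² + (t − 2)x − t, irrational as
-- t ≥ 1.  Since every positive integer is ⌊nα⌋ or ⌊mβ⌋ (n, m ≥ 1) but never both, and α > 1,
-- strong induction shows that ⌊nα⌋ is the least integer missing from the earlier terms.
-- Conversely, the increments of any sequence ⌊nβ + δ⌋ differ by at most 1.  The increments of
-- B are s times those of A plus t, so for s ≥ 2 those of A never increase; with A 0 = 0 and
-- A 1 = 1 this forces A n = n, and then A (s + t) = s + t = B 1 contradicts the mex condition.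

open import Defs

open import Data.Nat as ℕ using (ℕ; zero; suc; z≤n; s≤s; NonZero)
import Data.Nat.Properties as ℕₚ
open import Data.Integer as ℤ using (ℤ; +_; -[1+_]; 0ℤ; 1ℤ; +<+; +≤+; -<+)
import Data.Integer.Properties as ℤₚ
open import Data.Rational as ℚ using (ℚ; ↥_; ↧_; ↧ₙ_; 0ℚ; 1ℚ; *<*)
import Data.Rational.Properties as ℚₚ
open import Data.Sum using (_⊎_; inj₁; inj₂; fromInj₂)
open import Data.Product using (Σ; ∃; ∃₂; _×_; _,_; proj₁; proj₂)
open import Data.Empty using (⊥; ⊥-elim)
open import Relation.Nullary using (¬_; Dec; yes; no)
open import Relation.Binary.PropositionalEquality

module _ where
  open import Data.Nat using (_+_; _*_; _≤_)
  open import Data.Nat.Tactic.RingSolver using (solve-∀)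
  open import Data.Nat.GCD using (gcd; gcd[m,n]∣m; gcd[m,n]∣n; gcd[m,n]≢0)
  open import Data.Nat.Coprimality using (Coprime; coprime-/gcd; coprime-divisor)
  open import Data.Nat.Divisibility using (_∣_; ∣m+n∣m⇒∣n; n∣m*n; ∣-refl)
  open import Data.Nat.DivMod using (_/_; m/n*n≡m)

  IsRoot : ℕ → ℕ → ℕ → Set
  IsRoot t a b = a * a + t * a * b ≡ 2 * a * b + t * b * b

  IsRoot-cancel : ∀ t a b g .{{_ : NonZero g}} → IsRoot t (a * g) (b * g) → IsRoot t a b
  IsRoot-cancel t a b g root = ℕₚ.*-cancelˡ-≡ _ _ (g * g) (begin
    g * g * (a * a + t * a * b)                 ≡⟨ lhs t a b g ⟩
    a * g * (a * g) + t * (a * g) * (b * g)     ≡⟨ root ⟩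
    2 * (a * g) * (b * g) + t * (b * g) * (b * g) ≡⟨ rhs t a b g ⟩
    g * g * (2 * a * b + t * b * b)             ∎)
    where
    open ≡-Reasoning
    instance _ = ℕₚ.m*n≢0 g g
    lhs : ∀ t a b g → g * g * (a * a + t * a * b) ≡ a * g * (a * g) + t * (a * g) * (b * g)
    lhs = solve-∀
    rhs : ∀ t a b g → 2 * (a * g) * (b * g) + t * (b * g) * (b * g) ≡ g * g * (2 * a * b + t * b * b)
    rhs = solve-∀

  IsRoot-denominator : ∀ t {a b} → Coprime a b → IsRoot t a b → b ≡ 1
  IsRoot-denominator t {a} {b} coprime root = coprime (b∣a , ∣-refl)
    where
    rearranged : (2 * a + t * b) * b ≡ t * a * b + a * a
    rearranged = trans (e t a b) (trans (sym root) (ℕₚ.+-comm (a * a) _))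
      where
      e : ∀ t a b → (2 * a + t * b) * b ≡ 2 * a * b + t * b * b
      e = solve-∀
    b∣a : b ∣ a
    b∣a = coprime-divisor (Data.Nat.Coprimality.sym coprime)
            (∣m+n∣m⇒∣n (subst (b ∣_) rearranged (n∣m*n (2 * a + t * b))) (n∣m*n (t * a)))

  ¬IsRoot-integer : ∀ t-1 a → ¬ IsRoot (suc t-1) a 1
  ¬IsRoot-integer t-1 zero root = ℕₚ.0≢1+n (trans (sym (e t-1)) root)
    where
    e : ∀ t-1 → 0 * 0 + suc t-1 * 0 * 1 ≡ 0
    e = solve-∀
  ¬IsRoot-integer t-1 (suc zero) root = ℕₚ.1+n≢n (trans (sym (e₂ t-1)) (trans (sym root) (e₁ t-1)))
    where
    e₁ : ∀ t-1 → 1 * 1 + suc t-1 * 1 * 1 ≡ 2 + t-1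
    e₁ = solve-∀
    e₂ : ∀ t-1 → 2 * 1 * 1 + suc t-1 * 1 * 1 ≡ suc (2 + t-1)
    e₂ = solve-∀
  ¬IsRoot-integer t-1 (suc (suc k)) root =
    ℕₚ.m≢1+m+n (2 * suc (suc k) * 1 + suc t-1 * 1 * 1) (trans (sym root) (e t-1 k))
    where
    e : ∀ t-1 k → suc (suc k) * suc (suc k) + suc t-1 * suc (suc k) * 1
                ≡ suc ((2 * suc (suc k) * 1 + suc t-1 * 1 * 1) + ((k + 2) * k + t-1 * (k + 1) + k))
    e = solve-∀

  ¬IsRoot : ∀ t-1 a b → 1 ≤ b → ¬ IsRoot (suc t-1) a b
  ¬IsRoot t-1 a b 1≤b root = ¬IsRoot-integer t-1 a′ (subst (IsRoot (suc t-1) a′) b′≡1 root′)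
    where
    g = gcd a b
    instance _ = ℕ.≢-nonZero (gcd[m,n]≢0 a b (inj₂ λ b≡0 → ℕₚ.<⇒≢ 1≤b (sym b≡0)))
    a′ = a / g
    b′ = b / g
    root′ : IsRoot (suc t-1) a′ b′
    root′ = IsRoot-cancel (suc t-1) a′ b′ g (subst₂ (IsRoot (suc t-1)) (sym (m/n*n≡m (gcd[m,n]∣m a b)))
                                        (sym (m/n*n≡m (gcd[m,n]∣n a b))) root)
    b′≡1 : b′ ≡ 1
    b′≡1 = IsRoot-denominator (suc t-1) (coprime-/gcd a b) root′

first-crossing : (P : ℕ → Set) → (∀ k → Dec (P k)) → ¬ P 0 → ∀ {N} → P N → ∃ λ k → ¬ P k × P (suc k)
first-crossing P P? ¬P0 {zero} PN = ⊥-elim (¬P0 PN)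
first-crossing P P? ¬P0 {suc N} PN with P? N
... | yes PN′ = first-crossing P P? ¬P0 PN′
... | no ¬PN′ = N , ¬PN′ , PN

module _ where
  open import Data.Integer using (_+_; _*_; _-_; _<_; _≤_)
  open import Data.Integer.Tactic.RingSolver using (solve-∀)

  private variable i j : ℤ

  pos*pos⇒pos : 0ℤ < i → 0ℤ < j → 0ℤ < i * j
  pos*pos⇒pos {+ suc _} {+ suc _} _ _ = +<+ (s≤s z≤n)
  pos*pos⇒pos {+ zero} (+<+ ())
  pos*pos⇒pos {+ suc _} {+ zero} _ (+<+ ())

  nonNeg*nonNeg⇒nonNeg : 0ℤ ≤ i → 0ℤ ≤ j → 0ℤ ≤ i * j
  nonNeg*nonNeg⇒nonNeg {+ m} {+ n} _ _ = subst (0ℤ ≤_) (ℤₚ.pos-* m n) (+≤+ z≤n)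

  i<j⇒0<j-i : i < j → 0ℤ < j - i
  i<j⇒0<j-i {i} {j} i<j = subst (_< j - i) (ℤₚ.+-inverseʳ i) (ℤₚ.+-monoˡ-< (ℤ.- i) i<j)

  0<i-j⇒j<i : 0ℤ < i - j → j < i
  0<i-j⇒j<i {i} {j} 0<i-j = subst₂ _<_ (ℤₚ.+-identityˡ j) (e i j) (ℤₚ.+-monoˡ-< j 0<i-j)
    where
    e : ∀ i j → i - j + j ≡ i
    e = solve-∀

  pos⇒+suc : 0ℤ < i → ∃ λ n → + suc n ≡ i
  pos⇒+suc {+ suc n} _ = n , refl
  pos⇒+suc {+ zero} (+<+ ())

  nonNeg*nonPos⇒nonPos : 0ℤ ≤ i → j ≤ 0ℤ → i * j ≤ 0ℤ
  nonNeg*nonPos⇒nonPos {i} 0≤i j≤0 =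
    subst (i * _ ≤_) (ℤₚ.*-zeroʳ i) (ℤₚ.*-monoˡ-≤-nonNeg i {{ℤ.nonNegative 0≤i}} j≤0)

  <-by-difference : ∀ {k l} → j - i ≡ l - k → i < j → k < l
  <-by-difference eq i<j = 0<i-j⇒j<i (subst (0ℤ <_) eq (i<j⇒0<j-i i<j))

module _ where
  open import Data.Rational using (_+_; _*_; _-_; _<_; _≤_)
  open import Data.Rational.Solver using (module +-*-Solver)
  import Data.Rational.Unnormalised as ℚᵘ
  import Data.Rational.Unnormalised.Properties as ℚᵘₚ
  open import Data.Integer.Tactic.RingSolver using (solve-∀)

  0ℝ : ℝ
  0ℝ = record
    { lower = _< 0ℚ
    ; upper = 0ℚ <_
    ; lower-inh = ℚ.- 1ℚ , *<* -<+
    ; upper-inh = 1ℚ , *<* (+<+ (s≤s z≤n))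
    ; lower-rounded₁ = λ q q<0 → ℚₚ.<-dense q<0
    ; lower-rounded₂ = λ q r q<r r<0 → ℚₚ.<-trans q<r r<0
    ; upper-rounded₁ = λ r 0<r → let q , 0<q , q<r = ℚₚ.<-dense 0<r in q , q<r , 0<q
    ; upper-rounded₂ = λ q r q<r 0<q → ℚₚ.<-trans 0<q q<r
    ; disjoint = λ q (q<0 , 0<q) → ℚₚ.<-asym q<0 0<q
    ; located = below-or-above
    }
    where
    below-or-above : ∀ q r → q < r → q < 0ℚ ⊎ 0ℚ < r
    below-or-above q r q<r with q ℚₚ.<? 0ℚ
    ... | yes q<0 = inj₁ q<0
    ... | no q≮0 = inj₂ (ℚₚ.≤-<-trans (ℚₚ.≮⇒≥ q≮0) q<r)

  p<q⇒0<q-p : ∀ {p q} → p < q → 0ℚ < q - p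
  p<q⇒0<q-p {p} {q} p<q = subst (_< q - p) (ℚₚ.+-inverseʳ p) (ℚₚ.+-monoˡ-< (ℚ.- p) p<q)

  p+[q-p]≡q : ∀ p q → p + (q - p) ≡ q
  p+[q-p]≡q = solve 2 (λ p q → p :+ (q :- p) := q) refl
    where open +-*-Solver

  ℕ→ℚ-toℚᵘ : ∀ n → ℚ.toℚᵘ (ℕ→ℚ n) ℚᵘ.≃ ℚᵘ.mkℚᵘ (+ n) 0
  ℕ→ℚ-toℚᵘ n = ℚₚ.toℚᵘ-fromℚᵘ (ℚᵘ.mkℚᵘ (+ n) 0)

  ℕ→ℚ-+ : ∀ m n → ℕ→ℚ (m ℕ.+ n) ≡ ℕ→ℚ m + ℕ→ℚ n
  ℕ→ℚ-+ m n = ℚₚ.toℚᵘ-injective (begin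
    ℚ.toℚᵘ (ℕ→ℚ (m ℕ.+ n))                        ≈⟨ ℕ→ℚ-toℚᵘ (m ℕ.+ n) ⟩
    ℚᵘ.mkℚᵘ (+ (m ℕ.+ n)) 0                        ≈⟨ ℚᵘ.*≡* (trans (cong (ℤ._* + 1) (ℤₚ.pos-+ m n)) (e (+ m) (+ n))) ⟩
    ℚᵘ.mkℚᵘ (+ m) 0 ℚᵘ.+ ℚᵘ.mkℚᵘ (+ n) 0           ≈⟨ ℚᵘₚ.+-cong (ℚᵘₚ.≃-sym (ℕ→ℚ-toℚᵘ m)) (ℚᵘₚ.≃-sym (ℕ→ℚ-toℚᵘ n)) ⟩
    ℚ.toℚᵘ (ℕ→ℚ m) ℚᵘ.+ ℚ.toℚᵘ (ℕ→ℚ n)             ≈⟨ ℚᵘₚ.≃-sym (ℚₚ.toℚᵘ-homo-+ (ℕ→ℚ m) (ℕ→ℚ n)) ⟩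
    ℚ.toℚᵘ (ℕ→ℚ m + ℕ→ℚ n)                         ∎)
    where
    open ℚᵘₚ.≃-Reasoning
    e : ∀ m n → (m ℤ.+ n) ℤ.* + 1 ≡ (m ℤ.* + 1 ℤ.+ n ℤ.* + 1) ℤ.* + 1
    e = solve-∀

  ℕ→ℚ-suc : ∀ n → ℕ→ℚ (suc n) ≡ ℕ→ℚ n + 1ℚ
  ℕ→ℚ-suc n = trans (cong ℕ→ℚ (ℕₚ.+-comm 1 n)) (ℕ→ℚ-+ n 1)

  0≤ℕ→ℚ : ∀ n → 0ℚ ≤ ℕ→ℚ n
  0≤ℕ→ℚ n = ℚₚ.toℚᵘ-cancel-≤ (ℚᵘₚ.≤-respʳ-≃ (ℚᵘₚ.≃-sym (ℕ→ℚ-toℚᵘ n))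
    (ℚᵘ.*≤* (subst (0ℤ ℤ.≤_) (sym (ℤₚ.*-identityʳ (+ n))) (+≤+ z≤n))))

  ℕ→ℚ-cancel-< : ∀ {m n} → ℕ→ℚ m < ℕ→ℚ n → m ℕ.< n
  ℕ→ℚ-cancel-< {m} {n} m<n
    with ℚᵘₚ.<-respʳ-≃ (ℕ→ℚ-toℚᵘ n) (ℚᵘₚ.<-respˡ-≃ (ℕ→ℚ-toℚᵘ m) (ℚₚ.toℚᵘ-mono-< m<n))
  ... | ℚᵘ.*<* m<n′ = ℤₚ.drop‿+<+ (subst₂ ℤ._<_ (ℤₚ.*-identityʳ (+ m)) (ℤₚ.*-identityʳ (+ n)) m<n′)

  ℕ→ℚ*<ℕ→ℚ : ∀ n m a → ↥ a ℤ.* + n ℤ.< + m ℤ.* ↧ a → ℕ→ℚ n * a < ℕ→ℚ m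
  ℕ→ℚ*<ℕ→ℚ n m a@(ℚ.mkℚ p q-1 _) an<ma = ℚₚ.toℚᵘ-cancel-<
    (ℚᵘₚ.<-respʳ-≃ (ℚᵘₚ.≃-sym (ℕ→ℚ-toℚᵘ m))
      (ℚᵘₚ.<-respˡ-≃ (ℚᵘₚ.≃-sym (ℚᵘₚ.≃-trans (ℚₚ.toℚᵘ-homo-* (ℕ→ℚ n) a) (ℚᵘₚ.*-congʳ (ℕ→ℚ-toℚᵘ n))))
        (ℚᵘ.*<* (subst₂ ℤ._<_ (trans (ℤₚ.*-comm p (+ n)) (sym (ℤₚ.*-identityʳ _)))
                              (cong (λ d → + m ℤ.* + d) (sym (ℕₚ.*-identityˡ (suc q-1)))) an<ma))))

  ℕ→ℚ≤ℕ→ℚ* : ∀ n m a → + m ℤ.* ↧ a ℤ.≤ ↥ a ℤ.* + n → ℕ→ℚ m ≤ ℕ→ℚ n * a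
  ℕ→ℚ≤ℕ→ℚ* n m a@(ℚ.mkℚ p q-1 _) ma≤an = ℚₚ.toℚᵘ-cancel-≤
    (ℚᵘₚ.≤-respˡ-≃ (ℚᵘₚ.≃-sym (ℕ→ℚ-toℚᵘ m))
      (ℚᵘₚ.≤-respʳ-≃ (ℚᵘₚ.≃-sym (ℚᵘₚ.≃-trans (ℚₚ.toℚᵘ-homo-* (ℕ→ℚ n) a) (ℚᵘₚ.*-congʳ (ℕ→ℚ-toℚᵘ n))))
        (ℚᵘ.*≤* (subst₂ ℤ._≤_ (cong (λ d → + m ℤ.* + d) (sym (ℕₚ.*-identityˡ (suc q-1))))
                              (trans (ℤₚ.*-comm p (+ n)) (sym (ℤₚ.*-identityʳ _))) ma≤an))))

-- A real x presented through fractions: Below a b means a < b·x and Above a b means b·x < a.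
-- Every fraction with nonzero denominator lies on one side, so x is irrational.
record FractionCut : Set₁ where
  field
    Below Above     : ℤ → ℕ → Set
    below?          : ∀ a b → Dec (Below a b)
    above?          : ∀ a b → Dec (Above a b)
    below⊎above     : ∀ a b → 1 ℕ.≤ b → Below a b ⊎ Above a b
    below-above     : ∀ {a b c d} → 1 ℕ.≤ b → Below a b → Above c d → a ℤ.* + d ℤ.< c ℤ.* + b
    below-zero      : ∀ {a} → Below a 0 → a ℤ.< 0ℤ
    above-zero      : ∀ {a} → 0ℤ ℤ.< a → Above a 0
    above-zero⁻¹    : ∀ {a} → Above a 0 → 0ℤ ℤ.< a
    below-inhabited : ∃₂ λ a b → 1 ℕ.≤ b × Below a b
    above-inhabited : ∃₂ λ a b → 1 ℕ.≤ b × Above a b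
    below-open      : ∀ {a b} → 1 ℕ.≤ b → Below a b →
                      ∃₂ λ c d → 1 ℕ.≤ d × a ℤ.* + d ℤ.< c ℤ.* + b × Below c d
    above-open      : ∀ {a b} → 1 ℕ.≤ b → Above a b →
                      ∃₂ λ c d → 1 ℕ.≤ d × c ℤ.* + b ℤ.< a ℤ.* + d × Above c d

module CutTheory (C : FractionCut) where
  open FractionCut C public
  open import Data.Integer using (_+_; _*_; _-_; _<_; _≤_)
  open import Data.Integer.Tactic.RingSolver using (solve-∀)
  import Data.Rational.Unnormalised as ℚᵘ
  open import Data.Sum using (map₂)

  ¬below×above : ∀ {a b} → 1 ℕ.≤ b → Below a b → Above a b → ⊥
  ¬below×above 1≤b below above = ℤₚ.<-irrefl refl (below-above 1≤b below above)

  ¬above⇒below : ∀ {a b} → 1 ℕ.≤ b → ¬ Above a b → Below a b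
  ¬above⇒below {a} {b} 1≤b ¬above with below⊎above a b 1≤b
  ... | inj₁ below = below
  ... | inj₂ above = ⊥-elim (¬above above)

  ¬below⇒above : ∀ {a b} → 1 ℕ.≤ b → ¬ Below a b → Above a b
  ¬below⇒above {a} {b} 1≤b ¬below with below⊎above a b 1≤b
  ... | inj₁ below = ⊥-elim (¬below below)
  ... | inj₂ above = above

  below-cross : ∀ {a b c d} → 1 ℕ.≤ b → 1 ℕ.≤ d → Below c d → a * + d ≤ c * + b → Below a b
  below-cross 1≤b 1≤d below ad≤cb =
    ¬above⇒below 1≤b λ above → ℤₚ.<⇒≱ (below-above 1≤d below above) ad≤cb

  above-cross : ∀ {a b c d} → 1 ℕ.≤ b → Above c d → c * + b ≤ a * + d → Above a b
  above-cross 1≤b above cb≤ad =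
    ¬below⇒above 1≤b λ below → ℤₚ.<⇒≱ (below-above 1≤b below above) cb≤ad

  below-mono : ∀ {a c n} → 1 ℕ.≤ n → Below c n → a ≤ c → Below a n
  below-mono {n = n} 1≤n below a≤c = below-cross 1≤n 1≤n below (ℤₚ.*-monoʳ-≤-nonNeg (+ n) a≤c)

  above-mono : ∀ {a c n} → Above c n → c ≤ a → Above a n
  above-mono {n = zero} above c≤a = above-zero (ℤₚ.<-≤-trans (above-zero⁻¹ above) c≤a)
  above-mono {n = suc n} above c≤a = above-cross (s≤s z≤n) above (ℤₚ.*-monoʳ-≤-nonNeg (+ suc n) c≤a)

  mediant-below : ∀ {a b c d} → 1 ℕ.≤ d → ¬ Above a b → Below c d → Below (a + c) (b ℕ.+ d)
  mediant-below {a} {b} {c} {d} 1≤d ¬above below =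
    ¬above⇒below 1≤b+d λ above → ℤₚ.<⇒≱ (cb<ad above) (ad≤cb ¬above above)
    where
    1≤b+d = ℕₚ.≤-trans 1≤d (ℕₚ.m≤n+m d b)
    cb<ad : Above (a + c) (b ℕ.+ d) → c * + b < a * + d
    cb<ad above = <-by-difference (e a (+ b) c (+ d)) (below-above 1≤d below above)
      where
      e : ∀ a b c d → (a + c) * d - c * (b + d) ≡ a * d - c * b
      e = solve-∀
    ad≤cb : ∀ {b} → ¬ Above a b → Above (a + c) (b ℕ.+ d) → a * + d ≤ c * + b
    ad≤cb {zero} ¬above _ = subst (a * + d ≤_) (sym (ℤₚ.*-zeroʳ c))
      (ℤₚ.*-monoʳ-≤-nonNeg (+ d) (ℤₚ.≮⇒≥ λ 0<a → ¬above (above-zero 0<a)))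
    ad≤cb {suc b} ¬above above = ℤₚ.<⇒≤ (<-by-difference (e a (+ suc b) c (+ d))
      (below-above (s≤s z≤n) (¬above⇒below (s≤s z≤n) ¬above) above))
      where
      e : ∀ a b c d → (a + c) * b - a * (b + d) ≡ c * b - a * d
      e = solve-∀

  IsFloor : ℕ → ℕ → Set
  IsFloor k n = ¬ Above (+ k) n × Above (+ suc k) n

  IsFloor-unique : ∀ {k l n} → IsFloor k n → IsFloor l n → k ≡ l
  IsFloor-unique {k} {l} floor-k floor-l = ℕₚ.≤-antisym (≤ floor-k floor-l) (≤ floor-l floor-k)
    where
    ≤ : ∀ {k l n} → IsFloor k n → IsFloor l n → k ℕ.≤ l
    ≤ {k} {l} (¬above-k , _) (_ , above-l+1) =
      ℕₚ.≮⇒≥ λ l<k → ¬above-k (above-mono above-l+1 (+≤+ l<k))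

  floor-exists : ∀ {n N} → ¬ Above 0ℤ n → Above (+ N) n → ∃ λ k → IsFloor k n
  floor-exists {n} ¬above-0 above-N = first-crossing (λ k → Above (+ k) n) (λ k → above? (+ k) n) ¬above-0 above-N

  Lower Upper : ℚ → Set
  Lower q = Below (↥ q) (↧ₙ q)
  Upper q = Above (↥ q) (↧ₙ q)

  private
    fraction : ℤ → (d : ℕ) → 1 ℕ.≤ d → ℚ
    fraction c (suc d-1) _ = ℚ.fromℚᵘ (ℚᵘ.mkℚᵘ c d-1)

    fraction-cross : ∀ c d (1≤d : 1 ℕ.≤ d) → ↥ fraction c d 1≤d * + d ≡ c * ↧ fraction c d 1≤d
    fraction-cross c (suc d-1) _ = cross (c ℚ./ suc d-1) (ℚₚ.toℚᵘ-fromℚᵘ (ℚᵘ.mkℚᵘ c d-1))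
      where
      cross : ∀ q {p} → ℚ.toℚᵘ q ℚᵘ.≃ p → ↥ q * ℚᵘ.↧ p ≡ ℚᵘ.↥ p * ↧ q
      cross (ℚ.mkℚ _ _ _) (ℚᵘ.*≡* eq) = eq

    cross-<-fraction : ∀ {a b c d} (1≤d : 1 ℕ.≤ d) → a * + d < c * + b →
                       a * ↧ fraction c d 1≤d < ↥ fraction c d 1≤d * + b
    cross-<-fraction {a} {b} {c} {d} 1≤d ad<cb = ℤₚ.*-cancelʳ-<-nonNeg (+ d) (begin-strict
      a * ↧f * + d      ≡⟨ e a ↧f (+ d) ⟩
      a * + d * ↧f      <⟨ ℤₚ.*-monoʳ-<-pos ↧f ad<cb ⟩
      c * + b * ↧f      ≡⟨ e c (+ b) ↧f ⟩
      c * ↧f * + b      ≡⟨ cong (_* + b) (sym (fraction-cross c d 1≤d)) ⟩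
      ↥f * + d * + b    ≡⟨ e ↥f (+ d) (+ b) ⟩
      ↥f * + b * + d    ∎)
      where
      open ℤₚ.≤-Reasoning
      ↥f = ↥ fraction c d 1≤d
      ↧f = ↧ fraction c d 1≤d
      e : ∀ x y z → x * y * z ≡ x * z * y
      e = solve-∀

    cross-fraction-< : ∀ {a b c d} (1≤d : 1 ℕ.≤ d) → c * + b < a * + d →
                       ↥ fraction c d 1≤d * + b < a * ↧ fraction c d 1≤d
    cross-fraction-< {a} {b} {c} {d} 1≤d cb<ad = ℤₚ.*-cancelʳ-<-nonNeg (+ d) (begin-strict
      ↥f * + b * + d    ≡⟨ e ↥f (+ b) (+ d) ⟩
      ↥f * + d * + b    ≡⟨ cong (_* + b) (fraction-cross c d 1≤d) ⟩
      c * ↧f * + b      ≡⟨ e c ↧f (+ b) ⟩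
      c * + b * ↧f      <⟨ ℤₚ.*-monoʳ-<-pos ↧f cb<ad ⟩
      a * + d * ↧f      ≡⟨ e a (+ d) ↧f ⟩
      a * ↧f * + d      ∎)
      where
      open ℤₚ.≤-Reasoning
      ↥f = ↥ fraction c d 1≤d
      ↧f = ↧ fraction c d 1≤d
      e : ∀ x y z → x * y * z ≡ x * z * y
      e = solve-∀

    lower-fraction : ∀ {c d} (1≤d : 1 ℕ.≤ d) → Below c d → Lower (fraction c d 1≤d)
    lower-fraction {c} {d} 1≤d below = below-cross (s≤s z≤n) 1≤d below (ℤₚ.≤-reflexive (fraction-cross c d 1≤d))

    upper-fraction : ∀ {c d} (1≤d : 1 ℕ.≤ d) → Above c d → Upper (fraction c d 1≤d)
    upper-fraction {c} {d} 1≤d above = above-cross (s≤s z≤n) above (ℤₚ.≤-reflexive (sym (fraction-cross c d 1≤d)))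

  upper-inhabited : ∃ Upper
  upper-inhabited = let c , d , 1≤d , above = above-inhabited in fraction c d 1≤d , upper-fraction 1≤d above

  private
    upper-upward : ∀ q r → q ℚ.< r → Upper q → Upper r
    upper-upward q r (*<* q<r) above = above-cross (s≤s z≤n) above (ℤₚ.<⇒≤ q<r)

  toℝ : ℝ
  toℝ = record
    { lower = Lower
    ; upper = Upper
    ; lower-inh = let c , d , 1≤d , below = below-inhabited in fraction c d 1≤d , lower-fraction 1≤d below
    ; upper-inh = upper-inhabited
    ; lower-rounded₁ = λ q below → let c , d , 1≤d , qd<cq , below′ = below-open (s≤s z≤n) below
                                   in fraction c d 1≤d , *<* (cross-<-fraction {↥ q} {↧ₙ q} 1≤d qd<cq) ,
                                      lower-fraction 1≤d below′
    ; lower-rounded₂ = λ { q r (*<* q<r) below → below-cross (s≤s z≤n) (s≤s z≤n) below (ℤₚ.<⇒≤ q<r) }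
    ; upper-rounded₁ = λ r above → let c , d , 1≤d , cr<rd , above′ = above-open (s≤s z≤n) above
                                   in fraction c d 1≤d , *<* (cross-fraction-< {↥ r} {↧ₙ r} 1≤d cr<rd) ,
                                      upper-fraction 1≤d above′
    ; upper-rounded₂ = upper-upward
    ; disjoint = λ q (below , above) → ¬below×above (s≤s z≤n) below above
    ; located = λ q r q<r → map₂ (upper-upward q r q<r) (below⊎above (↥ q) (↧ₙ q) (s≤s z≤n))
    }

  private
    ¬above⇒≤-upper : ∀ {k n} q → ¬ Above (+ k) n → Upper q → + k * ↧ q ≤ ↥ q * + n
    ¬above⇒≤-upper {zero} {zero} q _ _ = ℤₚ.≤-reflexive (sym (ℤₚ.*-zeroʳ (↥ q)))
    ¬above⇒≤-upper {suc k} {zero} q ¬above _ = ⊥-elim (¬above (above-zero (+<+ (s≤s z≤n))))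
    ¬above⇒≤-upper {n = suc n} q ¬above above = ℤₚ.<⇒≤ (below-above (s≤s z≤n) (¬above⇒below (s≤s z≤n) ¬above) above)

    upper-witness : ∀ {k n} → Above (+ suc k) n → ∃ λ q → Upper q × ↥ q * + n < + suc k * ↧ q
    upper-witness {k} {zero} _ =
      let q , upper = upper-inhabited
      in q , upper , subst (_< + suc k * ↧ q) (sym (ℤₚ.*-zeroʳ (↥ q)))
                       (pos*pos⇒pos {+ suc k} {↧ q} (+<+ (s≤s z≤n)) (+<+ (s≤s z≤n)))
    upper-witness {k} {suc n} above =
      let c , d , 1≤d , lt , above′ = above-open (s≤s z≤n) above
      in fraction c d 1≤d , upper-fraction 1≤d above′ , cross-fraction-< {+ suc k} {suc n} 1≤d lt

  IsFloor⇒FloorLinEq : ∀ {k n} → IsFloor k n → FloorLinEq toℝ 0ℝ n k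
  IsFloor⇒FloorLinEq {k} {n} (¬above , above) = ¬line<k , line<k+1
    where
    ¬line<k : ¬ LinLt toℝ 0ℝ n (ℕ→ℚ k)
    ¬line<k (a , b , upper-a , 0<b , na+b<k) =
      ℚₚ.<-asym na+b<k (ℚₚ.≤-<-trans (ℕ→ℚ≤ℕ→ℚ* n k a (¬above⇒≤-upper a ¬above upper-a)) na<na+b)
      where
      na<na+b : ℕ→ℚ n ℚ.* a ℚ.< ℕ→ℚ n ℚ.* a ℚ.+ b
      na<na+b = subst (ℚ._< ℕ→ℚ n ℚ.* a ℚ.+ b) (ℚₚ.+-identityʳ _) (ℚₚ.+-monoʳ-< (ℕ→ℚ n ℚ.* a) 0<b)
    line<k+1 : LinLt toℝ 0ℝ n (ℕ→ℚ (suc k))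
    line<k+1 =
      let a , upper-a , an<k+1 = upper-witness above
          r , na<r , r<k+1 = ℚₚ.<-dense (ℕ→ℚ*<ℕ→ℚ n (suc k) a an<k+1)
      in a , r ℚ.- ℕ→ℚ n ℚ.* a , upper-a , p<q⇒0<q-p na<r ,
         subst (ℚ._< ℕ→ℚ (suc k)) (sym (p+[q-p]≡q (ℕ→ℚ n ℚ.* a) r)) r<k+1

  ¬below-0 : ∀ k → ¬ Below (+ k) 0
  ¬below-0 k below = ℤₚ.<⇒≱ (below-zero below) (+≤+ z≤n)

  ¬below⇒above-suc : ∀ {k n} → ¬ Below (+ suc k) n → Above (+ suc k) n
  ¬below⇒above-suc {n = zero} _ = above-zero (+<+ (s≤s z≤n))
  ¬below⇒above-suc {n = suc _} ¬below = ¬below⇒above (s≤s z≤n) ¬below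

  below-above-numerator : ∀ {j k b} → 1 ℕ.≤ b → Below (+ j) b → Above (+ k) b → j ℕ.< k
  below-above-numerator {b = b} 1≤b below above =
    ℤₚ.drop‿+<+ (ℤₚ.*-cancelʳ-<-nonNeg (+ b) (below-above 1≤b below above))

  below-above-denominator : ∀ {k b d} → 1 ℕ.≤ b → Below (+ k) b → Above (+ k) d → d ℕ.< b
  below-above-denominator {k} 1≤b below above =
    ℤₚ.drop‿+<+ (ℤₚ.*-cancelˡ-<-nonNeg (+ k) (below-above 1≤b below above))

  floor-or-above : ∀ k {N} → Below (+ suc k) N →
                   (∃ λ n → IsFloor k n) ⊎ (∃ λ n → Above (+ k) n × Below (+ suc k) (suc n))
  floor-or-above k below-N with first-crossing (λ n → Below (+ suc k) n) (λ n → below? _ n) (¬below-0 (suc k)) below-N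
  ... | n , ¬below-n , below-n+1 with above? (+ k) n
  ...   | no ¬above-n = inj₁ (n , ¬above-n , ¬below⇒above-suc ¬below-n)
  ...   | yes above-n = inj₂ (n , above-n , below-n+1)

module _ where
  open import Data.Integer using (_+_; _*_; _-_; _<_)
  open import Data.Integer.Tactic.RingSolver using (solve-∀)

  private
    shift-zero : ∀ u a → a - + u * + 0 ≡ a
    shift-zero u a = e (+ u) a
      where
      e : ∀ u a → a - u * 0ℤ ≡ a
      e = solve-∀

    unshift : ∀ u c d → (c + + u * + d) - + u * + d ≡ c
    unshift u c d = e (+ u) c (+ d)
      where
      e : ∀ u c d → (c + u * d) - u * d ≡ c
      e = solve-∀

  -- The cut of x + u: a < b·(x + u) iff a − u·b < b·x.
  shift : ℕ → FractionCut → FractionCut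
  shift u C = record
    { Below = Below′
    ; Above = Above′
    ; below? = λ a b → below? _ b
    ; above? = λ a b → above? _ b
    ; below⊎above = λ a b → below⊎above _ b
    ; below-above = λ {a} {b} {c} {d} 1≤b below above →
        <-by-difference (e₂ (+ u) a (+ b) c (+ d)) (below-above 1≤b below above)
    ; below-zero = λ {a} below → subst (_< 0ℤ) (shift-zero u a) (below-zero below)
    ; above-zero = λ {a} 0<a → above-zero (subst (0ℤ <_) (sym (shift-zero u a)) 0<a)
    ; above-zero⁻¹ = λ {a} above → subst (0ℤ <_) (shift-zero u a) (above-zero⁻¹ above)
    ; below-inhabited = let c , d , 1≤d , below = below-inhabited in
        c + + u * + d , d , 1≤d , subst (λ c → Below c d) (sym (unshift u c d)) below
    ; above-inhabited = let c , d , 1≤d , above = above-inhabited in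
        c + + u * + d , d , 1≤d , subst (λ c → Above c d) (sym (unshift u c d)) above
    ; below-open = λ {a} {b} 1≤b below → let c , d , 1≤d , lt , below′ = below-open 1≤b below in
        c + + u * + d , d , 1≤d , <-by-difference (e₁ (+ u) a (+ b) c (+ d)) lt ,
        subst (λ c → Below c d) (sym (unshift u c d)) below′
    ; above-open = λ {a} {b} 1≤b above → let c , d , 1≤d , lt , above′ = above-open 1≤b above in
        c + + u * + d , d , 1≤d , <-by-difference (e₃ (+ u) a (+ b) c (+ d)) lt ,
        subst (λ c → Above c d) (sym (unshift u c d)) above′
    }
    where
    open FractionCut C
    Below′ Above′ : ℤ → ℕ → Set
    Below′ a b = Below (a - + u * + b) b
    Above′ a b = Above (a - + u * + b) b
    e₁ : ∀ u a b c d → c * b - (a - u * b) * d ≡ (c + u * d) * b - a * d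
    e₁ = solve-∀
    e₂ : ∀ u a b c d → (c - u * d) * b - (a - u * b) * d ≡ c * b - a * d
    e₂ = solve-∀
    e₃ : ∀ u a b c d → (a - u * b) * d - c * b ≡ a * d - (c + u * d) * b
    e₃ = solve-∀

  IsFloor-shift : ∀ C u {k n} → CutTheory.IsFloor C k n → CutTheory.IsFloor (shift u C) (k ℕ.+ u ℕ.* n) n
  IsFloor-shift C u {k} {n} (¬above , above) =
      (λ above′ → ¬above (subst (λ a → Above a n) (unshift-ℕ k) above′))
    , subst (λ a → Above a n) (sym (unshift-ℕ (suc k))) above
    where
    open FractionCut C
    unshift-ℕ : ∀ k → + (k ℕ.+ u ℕ.* n) - + u * + n ≡ + k
    unshift-ℕ k = trans (cong (_- + u * + n) (trans (ℤₚ.pos-+ k (u ℕ.* n)) (cong (_+_ (+ k)) (ℤₚ.pos-* u n))))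
                        (unshift u (+ k) n)

-- α ∈ (1, 2).  For a ≥ 0 the sign of G a b = b²(a/b − α)(a/b − α′), where α′ < 0 is the other
-- root of x² + (t − 2)x − t, decides whether a < bα or a > bα.
module QuadraticCut (t-1 : ℕ) where
  open import Data.Integer using (_+_; _*_; _-_; -_; _<_; _≤_)
  open import Data.Integer.Tactic.RingSolver using (solve-∀)
  open import Relation.Nullary.Decidable using (_⊎-dec_; _×-dec_)
  open import Relation.Binary.Definitions using (tri<; tri≈; tri>)

  t : ℕ
  t = suc t-1

  T : ℤ
  T = + t

  G : ℤ → ℤ → ℤ
  G a b = a * a + (T - + 2) * a * b - T * b * b

  Below Above : ℤ → ℕ → Set
  Below a b = a < 0ℤ ⊎ G a (+ b) < 0ℤ
  Above a b = 0ℤ < a × 0ℤ < G a (+ b)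

  private
    0≤+ : ∀ n → 0ℤ ≤ + n
    0≤+ n = +≤+ z≤n

    0<1 : 0ℤ < 1ℤ
    0<1 = +<+ (s≤s z≤n)

  G-scale : ∀ a b k → G (a * k) (b * k) ≡ k * k * G a b
  G-scale a b k = e T a b k
    where
    e : ∀ T a b k → let G = λ x y → x * x + (T - + 2) * x * y - T * y * y
                    in G (a * k) (b * k) ≡ k * k * G a b
    e = solve-∀

  G-den-0 : ∀ a → G a 0ℤ ≡ a * a
  G-den-0 a = e T a
    where
    e : ∀ T a → let G = λ x y → x * x + (T - + 2) * x * y - T * y * y in G a 0ℤ ≡ a * a
    e = solve-∀

  G-num-0 : ∀ b → G 0ℤ b ≡ - (T * b * b)
  G-num-0 b = e T b
    where
    e : ∀ T b → let G = λ x y → x * x + (T - + 2) * x * y - T * y * y in G 0ℤ b ≡ - (T * b * b)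
    e = solve-∀

  G-diagonal : ∀ a → G a a ≡ - (a * a)
  G-diagonal a = e T a
    where
    e : ∀ T a → let G = λ x y → x * x + (T - + 2) * x * y - T * y * y in G a a ≡ - (a * a)
    e = solve-∀

  G-ℕ : ∀ a b → G (+ a) (+ b) ≡ + (a ℕ.* a ℕ.+ t ℕ.* a ℕ.* b) - + (2 ℕ.* a ℕ.* b ℕ.+ t ℕ.* b ℕ.* b)
  G-ℕ a b = trans (e T (+ a) (+ b)) (sym (cong₂ _-_ (↑ a a a b) (trans (↑ (2 ℕ.* a) b b b)
                                                        (cong (λ x → x * + b + T * + b * + b) (ℤₚ.pos-* 2 a)))))
    where
    e : ∀ T a b → a * a + (T - + 2) * a * b - T * b * b ≡ (a * a + T * a * b) - (+ 2 * a * b + T * b * b)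
    e = solve-∀
    ↑ : ∀ x y z w → + (x ℕ.* y ℕ.+ t ℕ.* z ℕ.* w) ≡ + x * + y + T * + z * + w
    ↑ x y z w = trans (ℤₚ.pos-+ (x ℕ.* y) _)
      (cong₂ _+_ (ℤₚ.pos-* x y) (trans (ℤₚ.pos-* (t ℕ.* z) w) (cong (_* + w) (ℤₚ.pos-* t z))))

  private
    -- G x N − G y N = (x − y)(x + S) with S = y + (t − 2)N, and S > 0 since y·S = G y N + tN² > 0.
    G-increasing : ∀ {x y N} → 0ℤ ≤ x → 0ℤ < y → 0ℤ ≤ N → 0ℤ < G y N → y ≤ x → G y N ≤ G x N
    G-increasing {x} {y} {N} 0≤x 0<y 0≤N 0<Gy y≤x = ℤₚ.0≤i-j⇒j≤i (subst (0ℤ ≤_) (sym (e₂ T x y N))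
      (nonNeg*nonNeg⇒nonNeg (ℤₚ.i≤j⇒0≤j-i y≤x) (ℤₚ.<⇒≤ (ℤₚ.+-mono-<-≤ 0<S 0≤x))))
      where
      S = y + (T - + 2) * N
      e₁ : ∀ T y N → let G = λ x y → x * x + (T - + 2) * x * y - T * y * y
                     in y * (y + (T - + 2) * N) ≡ G y N + T * N * N
      e₁ = solve-∀
      e₂ : ∀ T x y N → let G = λ x y → x * x + (T - + 2) * x * y - T * y * y
                       in G x N - G y N ≡ (x - y) * ((y + (T - + 2) * N) + x)
      e₂ = solve-∀
      0<yS : 0ℤ < y * S
      0<yS = subst (0ℤ <_) (sym (e₁ T y N))
        (ℤₚ.+-mono-<-≤ 0<Gy (nonNeg*nonNeg⇒nonNeg (nonNeg*nonNeg⇒nonNeg (0≤+ t) 0≤N) 0≤N))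
      0<S : 0ℤ < S
      0<S = ℤₚ.*-cancelˡ-<-nonNeg y {{ℤ.nonNegative (ℤₚ.<⇒≤ 0<y)}} (subst (_< y * S) (sym (ℤₚ.*-zeroʳ y)) 0<yS)

  below-above : ∀ {a b c d} → 1 ℕ.≤ b → Below a b → Above c d → a * + d < c * + b
  below-above {a} {b} {c} {d} 1≤b below (0<c , 0<Gcd) with a ℤₚ.<? 0ℤ
  ... | yes a<0 = ℤₚ.≤-<-trans (nonPos*nonNeg a<0) (pos*pos⇒pos 0<c (+<+ 1≤b))
    where
    nonPos*nonNeg : a < 0ℤ → a * + d ≤ 0ℤ
    nonPos*nonNeg a<0 = subst (_≤ 0ℤ) (ℤₚ.*-comm (+ d) a) (nonNeg*nonPos⇒nonPos (0≤+ d) (ℤₚ.<⇒≤ a<0))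
  ... | no a≮0 = ℤₚ.≰⇒> λ cb≤ad → ℤₚ.<⇒≱ 0<Gy (ℤₚ.≤-trans (G-increasing 0≤x 0<y 0≤N 0<Gy cb≤ad) Gx≤0)
    where
    N = + b * + d
    0≤N = nonNeg*nonNeg⇒nonNeg (0≤+ b) (0≤+ d)
    0≤x = nonNeg*nonNeg⇒nonNeg (ℤₚ.≮⇒≥ a≮0) (0≤+ d)
    0<y = pos*pos⇒pos 0<c (+<+ 1≤b)
    Gab<0 : G a (+ b) < 0ℤ
    Gab<0 = fromInj₂ (λ a<0 → ⊥-elim (a≮0 a<0)) below
    Gx≤0 : G (a * + d) N ≤ 0ℤ
    Gx≤0 = subst (_≤ 0ℤ) (sym (G-scale a (+ b) (+ d)))
      (nonNeg*nonPos⇒nonPos (nonNeg*nonNeg⇒nonNeg (0≤+ d) (0≤+ d)) (ℤₚ.<⇒≤ Gab<0))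
    0<Gy : 0ℤ < G (c * + b) N
    0<Gy = subst (λ M → 0ℤ < G (c * + b) M) (ℤₚ.*-comm (+ d) (+ b))
      (subst (0ℤ <_) (sym (G-scale c (+ d) (+ b))) (pos*pos⇒pos (pos*pos⇒pos (+<+ 1≤b) (+<+ 1≤b)) 0<Gcd))

  below⊎above : ∀ a b → 1 ℕ.≤ b → Below a b ⊎ Above a b
  below⊎above -[1+ _ ] b _ = inj₁ (inj₁ -<+)
  below⊎above (+ a) b 1≤b with ℤₚ.<-cmp (G (+ a) (+ b)) 0ℤ
  ... | tri< G<0 _ _ = inj₁ (inj₂ G<0)
  ... | tri≈ _ G≡0 _ = ⊥-elim (¬IsRoot t-1 a b 1≤b (ℤₚ.+-injective (ℤₚ.i-j≡0⇒i≡j _ _ (trans (sym (G-ℕ a b)) G≡0))))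
  ... | tri> _ _ 0<G = inj₂ (0<a a 0<G , 0<G)
    where
    0<a : ∀ a → 0ℤ < G (+ a) (+ b) → 0ℤ < + a
    0<a zero 0<G = ⊥-elim (ℤₚ.<⇒≱ 0<G (subst (_≤ 0ℤ) (sym (G-num-0 (+ b)))
      (ℤₚ.neg-mono-≤ (nonNeg*nonNeg⇒nonNeg (nonNeg*nonNeg⇒nonNeg (0≤+ t) (0≤+ b)) (0≤+ b)))))
    0<a (suc _) _ = +<+ (s≤s z≤n)

  private
    square-nonNeg : ∀ a → 0ℤ ≤ a * a
    square-nonNeg (+ n) = nonNeg*nonNeg⇒nonNeg (0≤+ n) (0≤+ n)
    square-nonNeg -[1+ n ] = +≤+ z≤n

  below-zero : ∀ {a} → Below a 0 → a < 0ℤ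
  below-zero (inj₁ a<0) = a<0
  below-zero {a} (inj₂ G<0) = ⊥-elim (ℤₚ.<⇒≱ G<0 (subst (0ℤ ≤_) (sym (G-den-0 a)) (square-nonNeg a)))

  above-zero : ∀ {a} → 0ℤ < a → Above a 0
  above-zero {a} 0<a = 0<a , subst (0ℤ <_) (sym (G-den-0 a)) (pos*pos⇒pos 0<a 0<a)

  below-0/1 : Below 0ℤ 1
  below-0/1 = inj₂ (subst (_< 0ℤ) (sym (G-num-0 1ℤ)) (ℤₚ.neg-mono-< (+<+ (s≤s z≤n))))

  above-2/1 : Above (+ 2) 1
  above-2/1 = +<+ (s≤s z≤n) , subst (0ℤ <_) (sym (e T)) (+<+ (s≤s z≤n))
    where
    e : ∀ T → let G = λ x y → x * x + (T - + 2) * x * y - T * y * y in G (+ 2) 1ℤ ≡ T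
    e = solve-∀

  private
    -- n = 2a + tb + 1 is large enough for (na ± 1)/(nb) to stay on the same side of α as a/b.
    scale : ℤ → ℕ → ℤ
    scale a b = + 2 * a + T * + b + 1ℤ

    0<scale : ∀ a b → 0ℤ ≤ a → 0ℤ < scale a b
    0<scale a b 0≤a = ℤₚ.+-mono-≤-< (ℤₚ.+-mono-≤ (nonNeg*nonNeg⇒nonNeg (0≤+ 2) 0≤a)
                                                (nonNeg*nonNeg⇒nonNeg (0≤+ t) (0≤+ b))) 0<1

  below-open : ∀ {a b} → 1 ℕ.≤ b → Below a b → ∃₂ λ c d → 1 ℕ.≤ d × a * + d < c * + b × Below c d
  below-open { -[1+ a ]} {b} _ _ =
    0ℤ , 1 , s≤s z≤n , subst (_< 0ℤ * + b) (sym (ℤₚ.*-identityʳ -[1+ a ])) -<+ , below-0/1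
  below-open {+ a} {b} 1≤b below = n * + a + 1ℤ , suc d-1 , s≤s z≤n , ad<cb , inj₂ Gcd<0
    where
    n = scale (+ a) b
    0≤n = ℤₚ.<⇒≤ (0<scale (+ a) b (0≤+ a))
    scaled-denominator = pos⇒+suc (pos*pos⇒pos (0<scale (+ a) b (0≤+ a)) (+<+ 1≤b))
    d-1 = proj₁ scaled-denominator
    d≡nb = proj₂ scaled-denominator
    e₁ : ∀ n a b → (n * a + 1ℤ) * b - a * (n * b) ≡ b
    e₁ = solve-∀
    ad<cb : + a * + suc d-1 < (n * + a + 1ℤ) * + b
    ad<cb = subst (λ d → + a * d < (n * + a + 1ℤ) * + b) (sym d≡nb)
      (0<i-j⇒j<i (subst (0ℤ <_) (sym (e₁ n (+ a) (+ b))) (+<+ 1≤b)))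
    G<0 : G (+ a) (+ b) < 0ℤ
    G<0 = fromInj₂ (λ { (+<+ ()) }) below
    e₂ : ∀ T a b → let G = λ x y → x * x + (T - + 2) * x * y - T * y * y
                       n = + 2 * a + T * b + 1ℤ
                   in G (n * a + 1ℤ) (n * b) ≡ - (n * n * (0ℤ - (1ℤ + G a b)) + (+ 2 * a + T * b + + 2 * n * b))
    e₂ = solve-∀
    Gcd<0 : G (n * + a + 1ℤ) (+ suc d-1) < 0ℤ
    Gcd<0 = subst (λ d → G (n * + a + 1ℤ) d < 0ℤ) (sym d≡nb)
      (subst (_< 0ℤ) (sym (e₂ T (+ a) (+ b))) (ℤₚ.neg-mono-< (ℤₚ.+-mono-≤-< 0≤scaled 0<rest)))
      where
      0≤scaled : 0ℤ ≤ n * n * (0ℤ - (1ℤ + G (+ a) (+ b)))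
      0≤scaled = nonNeg*nonNeg⇒nonNeg (nonNeg*nonNeg⇒nonNeg 0≤n 0≤n) (ℤₚ.i≤j⇒0≤j-i (ℤₚ.i<j⇒suc[i]≤j G<0))
      0<rest : 0ℤ < + 2 * + a + T * + b + + 2 * n * + b
      0<rest = ℤₚ.+-mono-≤-< (ℤₚ.+-mono-≤ (nonNeg*nonNeg⇒nonNeg (0≤+ 2) (0≤+ a))
                                          (nonNeg*nonNeg⇒nonNeg (0≤+ t) (0≤+ b)))
                             (pos*pos⇒pos (pos*pos⇒pos {+ 2} (+<+ (s≤s z≤n)) (0<scale (+ a) b (0≤+ a))) (+<+ 1≤b))

  above-open : ∀ {a b} → 1 ℕ.≤ b → Above a b → ∃₂ λ c d → 1 ℕ.≤ d × c * + b < a * + d × Above c d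
  above-open {+ zero} _ (+<+ () , _)
  above-open {+ suc a-1} {b} 1≤b (_ , 0<G) = n * a - 1ℤ , suc d-1 , s≤s z≤n , cb<ad , 0<c , 0<Gcd
    where
    a = + suc a-1
    n = scale a b
    0<n = 0<scale a b (0≤+ (suc a-1))
    0≤n = ℤₚ.<⇒≤ 0<n
    scaled-denominator = pos⇒+suc (pos*pos⇒pos 0<n (+<+ 1≤b))
    d-1 = proj₁ scaled-denominator
    d≡nb = proj₂ scaled-denominator
    e₁ : ∀ n a b → a * (n * b) - (n * a - 1ℤ) * b ≡ b
    e₁ = solve-∀
    cb<ad : (n * a - 1ℤ) * + b < a * + suc d-1
    cb<ad = subst (λ d → (n * a - 1ℤ) * + b < a * d) (sym d≡nb)
      (0<i-j⇒j<i (subst (0ℤ <_) (sym (e₁ n a (+ b))) (+<+ 1≤b)))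
    e₂ : ∀ T a b → let n = + 2 * (1ℤ + a) + T * b + 1ℤ
                   in n * (1ℤ + a) - 1ℤ ≡ n * a + (+ 2 * a + T * b) + + 2
    e₂ = solve-∀
    0<c : 0ℤ < n * a - 1ℤ
    0<c = subst (0ℤ <_) (sym (e₂ T (+ a-1) (+ b))) (ℤₚ.+-mono-≤-<
      (ℤₚ.+-mono-≤ (nonNeg*nonNeg⇒nonNeg 0≤n (0≤+ a-1))
                   (ℤₚ.+-mono-≤ (nonNeg*nonNeg⇒nonNeg (0≤+ 2) (0≤+ a-1)) (nonNeg*nonNeg⇒nonNeg (0≤+ t) (0≤+ b))))
      (+<+ (s≤s z≤n)))
    e₃ : ∀ T a b → let G = λ x y → x * x + (T - + 2) * x * y - T * y * y
                       n = + 2 * a + T * b + 1ℤ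
                   in G (n * a - 1ℤ) (n * b) ≡ n * n * (G a b - 1ℤ) + (n + + 2 * n * b + 1ℤ)
    e₃ = solve-∀
    0<Gcd : 0ℤ < G (n * a - 1ℤ) (+ suc d-1)
    0<Gcd = subst (λ d → 0ℤ < G (n * a - 1ℤ) d) (sym d≡nb)
      (subst (0ℤ <_) (sym (e₃ T a (+ b))) (ℤₚ.+-mono-≤-<
        (nonNeg*nonNeg⇒nonNeg (nonNeg*nonNeg⇒nonNeg 0≤n 0≤n) (ℤₚ.i≤j⇒0≤j-i (ℤₚ.i<j⇒suc[i]≤j 0<G)))
        (ℤₚ.+-mono-≤-< (ℤₚ.+-mono-≤ 0≤n (nonNeg*nonNeg⇒nonNeg (nonNeg*nonNeg⇒nonNeg (0≤+ 2) 0≤n) (0≤+ b))) 0<1)))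

  α-cut : FractionCut
  α-cut = record
    { Below = Below
    ; Above = Above
    ; below? = λ a b → (a ℤₚ.<? 0ℤ) ⊎-dec (G a (+ b) ℤₚ.<? 0ℤ)
    ; above? = λ a b → (0ℤ ℤₚ.<? a) ×-dec (0ℤ ℤₚ.<? G a (+ b))
    ; below⊎above = below⊎above
    ; below-above = below-above
    ; below-zero = below-zero
    ; above-zero = above-zero
    ; above-zero⁻¹ = proj₁
    ; below-inhabited = 0ℤ , 1 , s≤s z≤n , below-0/1
    ; above-inhabited = + 2 , 1 , s≤s z≤n , above-2/1
    ; below-open = below-open
    ; above-open = above-open
    }

  β-cut : FractionCut
  β-cut = shift t α-cut

  below-diagonal : ∀ n → 1 ℕ.≤ n → Below (+ n) n
  below-diagonal n 1≤n =
    inj₂ (subst (_< 0ℤ) (sym (G-diagonal (+ n))) (ℤₚ.neg-mono-< (pos*pos⇒pos (+<+ 1≤n) (+<+ 1≤n))))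

  above-2n+1 : ∀ n → Above (+ suc (n ℕ.+ n)) n
  above-2n+1 n = +<+ (s≤s z≤n) , subst (0ℤ <_) (sym (e T (+ n)))
    (ℤₚ.+-mono-<-≤ 0<1 (ℤₚ.+-mono-≤ (ℤₚ.+-mono-≤ (nonNeg*nonNeg⇒nonNeg (nonNeg*nonNeg⇒nonNeg 0≤T 0≤n) 0≤n)
                                                 (nonNeg*nonNeg⇒nonNeg 0≤T 0≤n))
                                    (ℤₚ.+-mono-≤ 0≤n 0≤n)))
    where
    0≤T = 0≤+ t
    0≤n = 0≤+ n
    e : ∀ T x → let G = λ x y → x * x + (T - + 2) * x * y - T * y * y
                in G (1ℤ + (x + x)) x ≡ 1ℤ + ((T * x * x + T * x) + (x + x))
    e = solve-∀

  ¬above-0 : ∀ n → ¬ Above 0ℤ n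
  ¬above-0 n (0<0 , _) = ℤₚ.<-irrefl refl 0<0

  private
    G-complement : ∀ q c → G ((+ q + + c) - T * + c) (+ c) ≡ - G (+ q + + c) (+ q)
    G-complement q c = e T (+ q) (+ c)
      where
      e : ∀ T q c → let G = λ x y → x * x + (T - + 2) * x * y - T * y * y
                    in G ((q + c) - T * c) c ≡ - G (q + c) q
      e = solve-∀

    above-T/t-1 : Above T t-1
    above-T/t-1 = +<+ (s≤s z≤n) , subst (0ℤ <_) (sym (e (+ t-1))) (+<+ (s≤s z≤n))
      where
      e : ∀ s → let T = 1ℤ + s
                    G = λ x y → x * x + (T - + 2) * x * y - T * y * y
                in G T s ≡ T
      e = solve-∀

  -- The two lemmas below are 1/α + 1/β = 1 in the form (q + c)/q ≷ α ⇔ (q + c)/c ≶ β.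
  above⇒β-below : ∀ q c → Above (+ (q ℕ.+ c)) q → FractionCut.Below β-cut (+ (q ℕ.+ c)) c
  above⇒β-below q c (_ , 0<G) = inj₂ (subst (_< 0ℤ) (sym (G-complement q c)) (ℤₚ.neg-mono-< 0<G))

  below⇒β-above : ∀ q c → Below (+ (q ℕ.+ c)) q → FractionCut.Above β-cut (+ (q ℕ.+ c)) c
  below⇒β-above zero c below = ⊥-elim (ℤₚ.<⇒≱ (below-zero below) (0≤+ c))
  below⇒β-above q@(suc _) c below = 0<q+c-Tc , subst (0ℤ <_) (sym (G-complement q c)) (ℤₚ.neg-mono-< G<0)
    where
    G<0 : G (+ q + + c) (+ q) < 0ℤ
    G<0 = fromInj₂ (λ { (+<+ ()) }) below
    e : ∀ s q c → (1ℤ + s) * q - (q + c) * s ≡ (q + c) - (1ℤ + s) * c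
    e = solve-∀
    0<q+c-Tc : 0ℤ < (+ q + + c) - T * + c
    0<q+c-Tc = subst (0ℤ <_) (e (+ t-1) (+ q) (+ c)) (i<j⇒0<j-i (below-above (s≤s z≤n) below above-T/t-1))

module Complementary (t-1 : ℕ) where
  open QuadraticCut t-1 using (t; α-cut; β-cut; below-diagonal; above-2n+1; ¬above-0; above⇒β-below; below⇒β-above)
  open import Data.Nat using (_+_; _≤_; _<_)
  module α = CutTheory α-cut
  module β = CutTheory β-cut

  above⇒< : ∀ {k n} → 1 ≤ k → α.Above (+ k) n → n < k
  above⇒< {n = zero} 1≤k _ = 1≤k
  above⇒< {n = suc n} _ above = α.below-above-numerator (s≤s z≤n) (below-diagonal (suc n) (s≤s z≤n)) above

  α-floor-≥ : ∀ {k n} → α.IsFloor k n → n ≤ k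
  α-floor-≥ (_ , above) = ℕₚ.≤-pred (above⇒< (s≤s z≤n) above)

  α-below⇒β-below : ∀ {a n} → 1 ≤ n → α.Below a n → β.Below a n
  α-below⇒β-below {a} {n} 1≤n below = α.below-mono 1≤n below
    (ℤₚ.i-j≤i a (+ t ℤ.* + n) {{ℤ.nonNegative (nonNeg*nonNeg⇒nonNeg {+ t} {+ n} (+≤+ z≤n) (+≤+ z≤n))}})

  β-below-diagonal : ∀ n → 1 ≤ n → β.Below (+ n) n
  β-below-diagonal n 1≤n = α-below⇒β-below 1≤n (below-diagonal n 1≤n)

  α-floor-exists : ∀ n → ∃ λ k → α.IsFloor k n
  α-floor-exists n = α.floor-exists (¬above-0 n) (above-2n+1 n)

  α-floor-injective : ∀ {k i n} → α.IsFloor k i → α.IsFloor k n → i ≡ n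
  α-floor-injective floor-i floor-n = ℕₚ.≤-antisym (≤ floor-n floor-i) (≤ floor-i floor-n)
    where
    ≤ : ∀ {k i n} → α.IsFloor k i → α.IsFloor k n → n ≤ i
    ≤ {k} {i} (¬above-i , _) (_ , above-n) = ℕₚ.≤-pred (α.below-above-denominator (s≤s z≤n) below above-n)
      where
      below : α.Below (+ suc k) (suc i)
      below = subst₂ (λ a b → α.Below (+ a) b) (ℕₚ.+-comm k 1) (ℕₚ.+-comm i 1)
                (α.mediant-below (s≤s z≤n) ¬above-i (below-diagonal 1 (s≤s z≤n)))

  beatty-disjoint : ∀ {k n m} → 1 ≤ n → 1 ≤ m → α.IsFloor k n → β.IsFloor k m → ⊥
  beatty-disjoint {n = n} {m} 1≤n 1≤m floor-α@(¬above-α , above-α) (¬above-β , above-β)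
    with ℕₚ.m≤n⇒∃[o]m+o≡n (α-floor-≥ floor-α)
  ... | c , refl = ℕₚ.<⇒≱ c<m m≤c
    where
    c<m : c < m
    c<m = β.below-above-denominator {n + c} {m} {c} 1≤m (β.¬above⇒below {+ (n + c)} {m} 1≤m ¬above-β)
            (below⇒β-above n c (α.¬above⇒below 1≤n ¬above-α))
    m≤c : m ≤ c
    m≤c = ℕₚ.≤-pred (β.below-above-denominator {n + suc c} {suc c} {m} (s≤s z≤n)
            (above⇒β-below n (suc c) (subst (λ a → α.Above (+ a) n) (sym (ℕₚ.+-suc n c)) above-α))
            (subst (λ a → β.Above (+ a) m) (sym (ℕₚ.+-suc n c)) above-β))

  private
    ¬above-both : ∀ {k n m} → 1 ≤ k → α.Above (+ k) n → α.Below (+ suc k) (suc n) →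
                  β.Above (+ k) m → β.Below (+ suc k) (suc m) → ⊥
    ¬above-both {k} {n} {m} 1≤k above-α below-α above-β below-β with ℕₚ.m≤n⇒∃[o]m+o≡n (ℕₚ.<⇒≤ (above⇒< 1≤k above-α))
    ... | c , refl = ℕₚ.<⇒≱ m<c c≤m
      where
      1≤c : 1 ≤ c
      1≤c = ℕₚ.+-cancelˡ-≤ n 1 c (subst (_≤ n + c) (ℕₚ.+-comm 1 n) (above⇒< 1≤k above-α))
      m<c : m < c
      m<c = β.below-above-denominator {n + c} {c} {m} 1≤c (above⇒β-below n c above-α) above-β
      c≤m : c ≤ m
      c≤m = ℕₚ.≤-pred (β.below-above-denominator {suc n + c} {suc m} {c} (s≤s z≤n) below-β
                                                  (below⇒β-above (suc n) c below-α))

  beatty-covering : ∀ {k} → 1 ≤ k → (∃ λ n → α.IsFloor k n) ⊎ (∃ λ m → β.IsFloor k m)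
  beatty-covering {k} 1≤k = from-α (α.floor-or-above k {suc k} (below-diagonal (suc k) (s≤s z≤n)))
    where
    from-α : (∃ λ n → α.IsFloor k n) ⊎ (∃ λ n → α.Above (+ k) n × α.Below (+ suc k) (suc n)) →
             (∃ λ n → α.IsFloor k n) ⊎ (∃ λ m → β.IsFloor k m)
    from-α (inj₁ floor-α) = inj₁ floor-α
    from-α (inj₂ (n , above-α , below-α)) = from-β (β.floor-or-above k {suc k} (β-below-diagonal (suc k) (s≤s z≤n)))
      where
      from-β : (∃ λ m → β.IsFloor k m) ⊎ (∃ λ m → β.Above (+ k) m × β.Below (+ suc k) (suc m)) →
               (∃ λ n → α.IsFloor k n) ⊎ (∃ λ m → β.IsFloor k m)
      from-β (inj₁ floor-β) = inj₂ floor-β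
      from-β (inj₂ (m , above-β , below-β)) = ⊥-elim (¬above-both {k} {n} {m} 1≤k above-α below-α above-β below-β)

module Mex (A B : ℕ → ℕ) (mex : ∀ n → IsMex (InPrefix A B n) (A n)) where
  open import Data.Nat using (_≤_)

  A-0 : A 0 ≡ 0
  A-0 = ℕₚ.n≤0⇒n≡0 (ℕₚ.≮⇒≥ λ 0<A0 → let _ , i<0 , _ = proj₂ (mex 0) 0 0<A0 in ℕₚ.n≮0 i<0)

  A-pos : ∀ {n} → 1 ≤ n → 1 ≤ A n
  A-pos {n} 1≤n = ℕₚ.n≢0⇒n>0 λ An≡0 → proj₁ (mex n) (0 , 1≤n , inj₁ (trans A-0 (sym An≡0)))

module MexSolution (t-1 : ℕ) (A B : ℕ → ℕ) (mex : ∀ n → IsMex (InPrefix A B n) (A n))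
                   (B-def : ∀ n → B n ≡ 1 ℕ.* A n ℕ.+ suc t-1 ℕ.* n) where
  open import Data.Nat using (_+_; _*_; _≤_; _<_)
  open import Data.Nat.Induction using (<-rec)
  open QuadraticCut t-1 using (t; α-cut; ¬above-0)
  open Complementary t-1
  open Mex A B mex

  β-floor : ∀ {n} → α.IsFloor (A n) n → β.IsFloor (B n) n
  β-floor {n} floor = subst (λ k → β.IsFloor k n) (sym (trans (B-def n) (cong (_+ t * n) (ℕₚ.*-identityˡ (A n)))))
                            (IsFloor-shift α-cut t floor)

  B-0 : B 0 ≡ 0
  B-0 = trans (B-def 0) (trans (cong (λ a → 1 * a + t * 0) A-0) (ℕₚ.*-zeroʳ t))

  A-floor : ∀ n → α.IsFloor (A n) n
  A-floor = <-rec (λ n → α.IsFloor (A n) n) step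
    where
    step : ∀ n → (∀ {i} → i < n → α.IsFloor (A i) i) → α.IsFloor (A n) n
    step zero _ = subst (λ k → α.IsFloor k 0) (sym A-0) (¬above-0 0 , α.above-zero (+<+ (s≤s z≤n)))
    step n@(suc _) IH = ¬above , above
      where
      floor-new : ∀ {k} → α.IsFloor k n → ¬ InPrefix A B n k
      floor-new floor (i , i<n , inj₁ Ai≡k) =
        ℕₚ.<⇒≢ i<n (α-floor-injective (subst (λ k → α.IsFloor k i) Ai≡k (IH i<n)) floor)
      floor-new floor (zero , _ , inj₂ B0≡k) =
        ℕₚ.<⇒≱ (s≤s z≤n) (subst (n ≤_) (trans (sym B0≡k) B-0) (α-floor-≥ floor))
      floor-new floor (suc i , i<n , inj₂ Bi≡k) =
        beatty-disjoint (s≤s z≤n) (s≤s z≤n) floor (subst (λ k → β.IsFloor k (suc i)) Bi≡k (β-floor (IH i<n)))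

      ¬above : ¬ α.Above (+ A n) n
      ¬above above = floor-new floor-k (proj₂ (mex n) k k<An)
        where
        k = proj₁ (α-floor-exists n)
        floor-k = proj₂ (α-floor-exists n)
        k<An : k < A n
        k<An = ℕₚ.≰⇒> λ An≤k → proj₁ floor-k (α.above-mono above (+≤+ An≤k))

      above : α.Above (+ suc (A n)) n
      above = α.¬below⇒above (s≤s z≤n) λ below → earlier-term below (beatty-covering (A-pos (s≤s z≤n)))
        where
        earlier-term : α.Below (+ suc (A n)) n → (∃ λ j → α.IsFloor (A n) j) ⊎ (∃ λ j → β.IsFloor (A n) j) → ⊥
        earlier-term below (inj₁ (j , floor-j)) = proj₁ (mex n) (j , j<n , inj₁ (α.IsFloor-unique (IH j<n) floor-j))
          where
          j<n = α.below-above-denominator (s≤s z≤n) below (proj₂ floor-j)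
        earlier-term below (inj₂ (j , floor-j)) =
          proj₁ (mex n) (j , j<n , inj₂ (β.IsFloor-unique {B j} {A n} {j} (β-floor (IH j<n)) floor-j))
          where
          j<n = β.below-above-denominator {suc (A n)} {n} {j} (s≤s z≤n)
                  (α-below⇒β-below (s≤s z≤n) below) (proj₂ floor-j)

  B-floor : ∀ n → β.IsFloor (B n) n
  B-floor n = β-floor (A-floor n)

  floor-representation : Σ ℝ λ α → Σ ℝ λ γ → Σ ℝ λ β → Σ ℝ λ δ →
                         ∀ n → FloorLinEq α γ n (A n) × FloorLinEq β δ n (B n)
  floor-representation =
    α.toℝ , 0ℝ , β.toℝ , 0ℝ ,
    λ n → α.IsFloor⇒FloorLinEq {A n} {n} (A-floor n) , β.IsFloor⇒FloorLinEq {B n} {n} (B-floor n)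

module FloorSequence (α γ : ℝ) (X : ℕ → ℕ) (floor : ∀ n → FloorLinEq α γ n (X n)) where
  open import Data.Rational using (_+_; _*_; _-_; _<_; _≤_)
  open import Algebra.Solver.CommutativeMonoid ℚₚ.+-0-commutativeMonoid using (solve; _⊕_; _⊜_)

  private
    min-upper : ∀ x {p q} → upper x p → upper x q → ∃ λ r → upper x r × r ≤ p × r ≤ q
    min-upper x {p} {q} upper-p upper-q with ℚₚ.≤-total p q
    ... | inj₁ p≤q = p , upper-p , ℚₚ.≤-refl , p≤q
    ... | inj₂ q≤p = q , upper-q , q≤p , ℚₚ.≤-refl

    ℕ→ℚ*-monoʳ-≤ : ∀ n {p q} → p ≤ q → ℕ→ℚ n * p ≤ ℕ→ℚ n * q
    ℕ→ℚ*-monoʳ-≤ n = ℚₚ.*-monoˡ-≤-nonNeg (ℕ→ℚ n) {{ℚ.nonNegative (0≤ℕ→ℚ n)}}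

    +-cancelʳ-< : ∀ {p q} r → p + r < q + r → p < q
    +-cancelʳ-< {p} {q} r p+r<q+r = subst₂ _<_ (p+r-r≡p p) (p+r-r≡p q) (ℚₚ.+-monoˡ-< (ℚ.- r) p+r<q+r)
      where
      p+r-r≡p : ∀ p → p + r - r ≡ p
      p+r-r≡p p = trans (ℚₚ.+-assoc p r (ℚ.- r)) (trans (cong (_+_ p) (ℚₚ.+-inverseʳ r)) (ℚₚ.+-identityʳ p))

    line-suc : ∀ n a b → ℕ→ℚ (suc n) * a + b ≡ ℕ→ℚ n * a + b + a
    line-suc n a b = begin
      ℕ→ℚ (suc n) * a + b      ≡⟨ cong (λ x → x * a + b) (ℕ→ℚ-suc n) ⟩
      (ℕ→ℚ n + 1ℚ) * a + b     ≡⟨ cong (_+ b) (ℚₚ.*-distribʳ-+ a (ℕ→ℚ n) 1ℚ) ⟩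
      ℕ→ℚ n * a + 1ℚ * a + b   ≡⟨ cong (λ x → ℕ→ℚ n * a + x + b) (ℚₚ.*-identityˡ a) ⟩
      ℕ→ℚ n * a + a + b        ≡⟨ solve 3 (λ x a b → (x ⊕ a) ⊕ b ⊜ (x ⊕ b) ⊕ a) refl (ℕ→ℚ n * a) a b ⟩
      ℕ→ℚ n * a + b + a        ∎
      where open ≡-Reasoning

  X≤line : ∀ n {a b} → upper α a → upper γ b → ℕ→ℚ (X n) ≤ ℕ→ℚ n * a + b
  X≤line n {a} {b} upper-a upper-b = ℚₚ.≮⇒≥ λ lt → proj₁ (floor n) (a , b , upper-a , upper-b , lt)

  private
    step-below : ∀ n {a b} → upper α a → upper γ b →
                 ℕ→ℚ n * a + b < ℕ→ℚ (suc (X n)) → ℕ→ℚ (X (suc n)) < ℕ→ℚ (suc (X n)) + a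
    step-below n {a} {b} upper-a upper-b line-n = ℚₚ.≤-<-trans (X≤line (suc n) upper-a upper-b)
      (subst (_< ℕ→ℚ (suc (X n)) + a) (sym (line-suc n a b)) (ℚₚ.+-monoˡ-< a line-n))

    step-above : ∀ m {a b} → upper α a → upper γ b →
                 ℕ→ℚ (suc m) * a + b < ℕ→ℚ (suc (X (suc m))) → ℕ→ℚ (X m) + a < ℕ→ℚ (suc (X (suc m)))
    step-above m {a} {b} upper-a upper-b line-m+1 = ℚₚ.≤-<-trans (ℚₚ.+-monoˡ-≤ a (X≤line m upper-a upper-b))
      (subst (_< ℕ→ℚ (suc (X (suc m)))) (line-suc m a b) line-m+1)

  -- Upper bounds a of α and b of γ that lie under both lines n·a + b < X n + 1 and
  -- (m + 1)·a + b < X (m + 1) + 1 give X (n + 1) − X n < a + 1 and X (m + 1) − X m > a − 1.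
  floor-differences : ∀ n m → X (suc n) ℕ.+ X m ℕ.≤ suc (X n ℕ.+ X (suc m))
  floor-differences n m =
    let a₁ , b₁ , upper-a₁ , upper-b₁ , line-n = proj₂ (floor n)
        a₂ , b₂ , upper-a₂ , upper-b₂ , line-m+1 = proj₂ (floor (suc m))
        a , upper-a , a≤a₁ , a≤a₂ = min-upper α upper-a₁ upper-a₂
        b , upper-b , b≤b₁ , b≤b₂ = min-upper γ upper-b₁ upper-b₂
        below = step-below n upper-a upper-b (ℚₚ.≤-<-trans (ℚₚ.+-mono-≤ (ℕ→ℚ*-monoʳ-≤ n a≤a₁) b≤b₁) line-n)
        above = step-above m upper-a upper-b
                  (ℚₚ.≤-<-trans (ℚₚ.+-mono-≤ (ℕ→ℚ*-monoʳ-≤ (suc m) a≤a₂) b≤b₂) line-m+1)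
    in subst (X (suc n) ℕ.+ X m ℕ.≤_) (ℕₚ.+-suc (X n) (X (suc m))) (ℕₚ.≤-pred (ℕ→ℚ-cancel-< (+-cancelʳ-< a
         (subst₂ _<_ (regroup (X (suc n)) (X m) a) (regroup′ (suc (X n)) (suc (X (suc m))) a)
           (ℚₚ.+-mono-< below above)))))
    where
    regroup : ∀ x y a → ℕ→ℚ x + (ℕ→ℚ y + a) ≡ ℕ→ℚ (x ℕ.+ y) + a
    regroup x y a rewrite ℕ→ℚ-+ x y = solve 3 (λ x y a → x ⊕ (y ⊕ a) ⊜ (x ⊕ y) ⊕ a) refl (ℕ→ℚ x) (ℕ→ℚ y) a
    regroup′ : ∀ x y a → ℕ→ℚ x + a + ℕ→ℚ y ≡ ℕ→ℚ (x ℕ.+ y) + a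
    regroup′ x y a rewrite ℕ→ℚ-+ x y = solve 3 (λ x y a → (x ⊕ a) ⊕ y ⊜ (x ⊕ y) ⊕ a) refl (ℕ→ℚ x) (ℕ→ℚ y) a

module Necessity (s-2 t : ℕ) (A B : ℕ → ℕ) (mex : ∀ n → IsMex (InPrefix A B n) (A n))
                 (B-def : ∀ n → B n ≡ suc (suc s-2) ℕ.* A n ℕ.+ t ℕ.* n) where
  open import Data.Nat using (_+_; _*_; _≤_)
  open import Data.Nat.Tactic.RingSolver using (solve-∀)
  open Mex A B mex

  s : ℕ
  s = suc (suc s-2)

  private
    -- y < x would give s·x ≥ s·y + s ≥ s·y + 2.
    *-cancelˡ-≤-suc : ∀ x y → s * x ≤ suc (s * y) → x ≤ y
    *-cancelˡ-≤-suc x y sx≤1+sy = ℕₚ.≮⇒≥ λ y<x → ℕₚ.<⇒≱ (ℕₚ.≤-trans (s≤s (s≤s (ℕₚ.m≤n+m (s * y) s-2)))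
      (ℕₚ.≤-reflexive (sym (ℕₚ.*-suc s y)))) (ℕₚ.≤-trans (ℕₚ.*-monoʳ-≤ s y<x) sx≤1+sy)

  B-0 : B 0 ≡ 0
  B-0 = trans (B-def 0) (trans (cong (λ a → s * a + t * 0) A-0) (e s-2 t))
    where
    e : ∀ s-2 t → suc (suc s-2) * 0 + t * 0 ≡ 0
    e = solve-∀

  A-1 : A 1 ≡ 1
  A-1 = ℕₚ.≤-antisym (ℕₚ.≮⇒≥ λ 1<A1 → 1∉prefix (proj₂ (mex 1) 1 1<A1)) (A-pos (s≤s z≤n))
    where
    1∉prefix : ¬ InPrefix A B 1 1
    1∉prefix (zero , _ , inj₁ A0≡1) = ℕₚ.0≢1+n (trans (sym A-0) A0≡1)
    1∉prefix (zero , _ , inj₂ B0≡1) = ℕₚ.0≢1+n (trans (sym B-0) B0≡1)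
    1∉prefix (suc _ , s≤s () , _)

  module _ (β δ : ℝ) (floor-B : ∀ n → FloorLinEq β δ n (B n)) where
    open FloorSequence β δ B floor-B

    A-differences-decrease : ∀ n m → A (suc n) + A m ≤ A n + A (suc m)
    A-differences-decrease n m = *-cancelˡ-≤-suc _ _ (ℕₚ.+-cancelʳ-≤ (t * (suc n + m)) _ _
      (subst₂ _≤_ (e₁ s-2 t (A (suc n)) (A m) n m) (e₂ s-2 t (A n) (A (suc m)) n m)
        (subst₂ (λ x y → x ≤ suc y) (cong₂ _+_ (B-def (suc n)) (B-def m)) (cong₂ _+_ (B-def n) (B-def (suc m)))
          (floor-differences n m))))
      where
      e₁ : ∀ s-2 t a b n m → suc (suc s-2) * a + t * suc n + (suc (suc s-2) * b + t * m)
                           ≡ suc (suc s-2) * (a + b) + t * (suc n + m)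
      e₁ = solve-∀
      e₂ : ∀ s-2 t a b n m → suc (suc (suc s-2) * a + t * n + (suc (suc s-2) * b + t * suc m))
                           ≡ suc (suc (suc s-2) * (a + b)) + t * (suc n + m)
      e₂ = solve-∀

    A-identity : ∀ n → A n ≡ n
    A-identity zero = A-0
    A-identity (suc n) = ℕₚ.≤-antisym
      (subst₂ _≤_ (trans (cong (_+_ (A (suc n))) A-0) (ℕₚ.+-identityʳ _))
                  (trans (cong₂ _+_ (A-identity n) A-1) (ℕₚ.+-comm n 1))
              (A-differences-decrease n 0))
      (subst₂ _≤_ (cong₂ _+_ A-1 (A-identity n)) (cong (_+ A (suc n)) A-0) (A-differences-decrease 0 n))

    contradiction : ⊥
    contradiction = proj₁ (mex (s + t)) (1 , s≤s (s≤s z≤n) , inj₂ (trans B-1 (sym (A-identity (s + t)))))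
      where
      B-1 : B 1 ≡ s + t
      B-1 = trans (B-def 1) (cong₂ _+_ (trans (cong (_*_ s) A-1) (ℕₚ.*-identityʳ s)) (ℕₚ.*-identityʳ t))

open import Data.Nat using (_+_; _*_; _≥_)

theorem2 : (s t : ℕ) → s ≥ 1 → t ≥ 1 →
    (A B : ℕ → ℕ) →
    (∀ n → IsMex (InPrefix A B n) (A n)) →
    (∀ n → B n ≡ s * A n + t * n) →
    ((Σ ℝ λ α → Σ ℝ λ γ → Σ ℝ λ β → Σ ℝ λ δ →
        ∀ n → FloorLinEq α γ n (A n) × FloorLinEq β δ n (B n)) → s ≡ 1)
    × (s ≡ 1 → Σ ℝ λ α → Σ ℝ λ γ → Σ ℝ λ β → Σ ℝ λ δ →
        ∀ n → FloorLinEq α γ n (A n) × FloorLinEq β δ n (B n))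
theorem2 zero t () _ A B mex B-def
theorem2 (suc zero) zero _ () A B mex B-def
theorem2 (suc zero) (suc t-1) _ _ A B mex B-def =
  (λ _ → refl) , λ _ → MexSolution.floor-representation t-1 A B mex B-def
theorem2 (suc (suc s-2)) t _ _ A B mex B-def =
  (λ (_ , _ , β , δ , floor) → ⊥-elim (Necessity.contradiction s-2 t A B mex B-def β δ (λ n → proj₂ (floor n)))) ,
  λ ()
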